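{- For all odd $n \geq 3$, $\mathsf{DL}(L_{2,n}) = r(L_{2,n}) = (n+1)/2$.
   Context: $L_{m,n}$ is the $m\times n$ grid graph, i.e. the Cartesian product of a path on $m$ vertices and a path on $n$ vertices. For a finite connected graph $G=(V,E)$ with $|V|=N$ and graph distance $d$, a $k$-dispersed labelling is a bijection $\phi:\{1,\dots,N\}\to V$ with $d(\phi(i),\phi(i+1))\ge k$ for $1\le i\le N-1$; $\mathsf{DL}(G)$ is the maximum such $k$. $r(G)=\min_v\max_u d(v,u)$ is the radius. -}

module Defs where

open import Data.Nat using (ℕ; zero; suc; _≤_; _*_)
open import Data.Fin using (Fin; toℕ)
open import Data.Product using (_×_; ∃; Σ)
open import Data.Sum using (_⊎_)
open import Relation.Binary.PropositionalEquality using (_≡_)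
open import Function.Definitions using (Bijective)

record Graph : Set₁ where
  field
    V   : Set
    Adj : V → V → Set

open Graph public

data Walk (G : Graph) : V G → V G → ℕ → Set where
  here : ∀ {u} → Walk G u u zero
  step : ∀ {u w v k} → Adj G u w → Walk G w v k → Walk G u v (suc k)

Dist : (G : Graph) → V G → V G → ℕ → Set
Dist G u v d = Walk G u v d × (∀ k → Walk G u v k → d ≤ k)

Ecc : (G : Graph) → V G → ℕ → Set
Ecc G v e = (∀ u d → Dist G v u d → d ≤ e) × ∃ λ u → Dist G v u e

IsRadius : (G : Graph) → ℕ → Set
IsRadius G r = (∃ λ v → Ecc G v r) × (∀ v e → Ecc G v e → r ≤ e)

-- k-dispersed labelling of a graph with N vertices: a bijection
-- φ : Fin N → V (labels 0..N-1 instead of 1..N) with consecutive labels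
-- at distance ≥ k.
Dispersed : (G : Graph) (N : ℕ) → (Fin N → V G) → ℕ → Set
Dispersed G N φ k =
  Bijective _≡_ _≡_ φ ×
  (∀ (i j : Fin N) → toℕ j ≡ suc (toℕ i) →
     ∀ d → Dist G (φ i) (φ j) d → k ≤ d)

IsDL : (G : Graph) (N : ℕ) → ℕ → Set
IsDL G N k =
  (Σ (Fin N → V G) λ φ → Dispersed G N φ k) ×
  (∀ k' → Σ (Fin N → V G) (λ φ → Dispersed G N φ k') → k' ≤ k)

PathAdj : ∀ {m} → Fin m → Fin m → Set
PathAdj x y = toℕ x ≡ suc (toℕ y) ⊎ toℕ y ≡ suc (toℕ x)

L : ℕ → ℕ → Graph
L m n = record
  { V   = Fin m × Fin n
  ; Adj = λ { (a , i) (b , j) → (a ≡ b × PathAdj i j) ⊎ (PathAdj a b × i ≡ j) }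
  }
  where open import Data.Product using (_,_)

-- Distances in the grid are Manhattan distances. For n = 2m + 1 the vertex (0, m) is within
-- m + 1 of every vertex, and every vertex is at distance at least m + 1 from the vertex in the
-- other row at the far end, so the radius is m + 1. The label of (0, m) has a neighbouring
-- label, so no labelling is more than (m + 1)-dispersed. Conversely, sending label 2t to (0, t)
-- and label 2t + 1 to (1, t + m + 1 mod n) changes row at every step, while the columns of
-- consecutive labels differ by m or m + 1.
module Submission where

open import Defs
open import Data.Nat using (ℕ; zero; suc; _+_; _*_; _∸_; _≤_; z≤n; s≤s; s≤s⁻¹; ∣_-_∣; _%_; _/_; ⌊_/2⌋)
open import Data.Nat.Properties
open import Data.Nat.DivMod using (m≡m%n+[m/n]*n)
open import Data.Fin using (Fin; toℕ; fromℕ; fromℕ<; inject₁; cast; splitAt; _↑ˡ_; _↑ʳ_; remQuot; combine)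
open import Data.Fin.Patterns using (0F; 1F)
open import Data.Fin.Properties
  using (toℕ<n; toℕ-injective; toℕ-fromℕ; toℕ-fromℕ<; toℕ-inject₁; toℕ-cast; cast-involutive;
         toℕ-↑ˡ; toℕ-↑ʳ; splitAt⁻¹-↑ˡ; splitAt⁻¹-↑ʳ; +↔⊎; *↔×; toℕ-combine; combine-remQuot)
open import Data.Product using (_×_; _,_; proj₁; proj₂; ∃)
open import Data.Sum using (_⊎_; inj₁; inj₂)
open import Data.Sum.Algebra using (⊎-comm)
open import Data.Empty using (⊥-elim)
open import Function using (_∘_)
open import Function.Bundles using (_↔_; Inverse; mk↔ₛ′; Bijection)
open import Function.Construct.Composition using (_↔-∘_)
open import Function.Properties.Inverse using (↔-sym; Inverse⇒Bijection)
open import Relation.Binary.PropositionalEquality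
open import Algebra.Properties.CommutativeSemigroup +-commutativeSemigroup using (interchange)

PathAdj-suc : ∀ {k} {i j : Fin k} → PathAdj i j → PathAdj (Fin.suc i) (Fin.suc j)
PathAdj-suc (inj₁ e) = inj₁ (cong suc e)
PathAdj-suc (inj₂ e) = inj₂ (cong suc e)

PathAdj⇒∣-∣≡1 : ∀ {k} {i j : Fin k} → PathAdj i j → ∣ toℕ i - toℕ j ∣ ≡ 1
PathAdj⇒∣-∣≡1 {j = j} (inj₁ i≡1+j) rewrite i≡1+j =
  trans (m≤n⇒∣n-m∣≡n∸m (n≤1+n (toℕ j))) (m+n∸n≡m 1 (toℕ j))
PathAdj⇒∣-∣≡1 {i = i} (inj₂ j≡1+i) rewrite j≡1+i =
  trans (m≤n⇒∣m-n∣≡n∸m (n≤1+n (toℕ i))) (m+n∸n≡m 1 (toℕ i))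

module _ {G : Graph} where

  walk-snoc : ∀ {u v w k} → Walk G u v k → Adj G v w → Walk G u w (suc k)
  walk-snoc here       a = step a here
  walk-snoc (step b p) a = step b (walk-snoc p a)

  _++ʷ_ : ∀ {u v w k l} → Walk G u v k → Walk G v w l → Walk G u w (k + l)
  here     ++ʷ q = q
  step a p ++ʷ q = step a (p ++ʷ q)

  walkAlongPath : ∀ {k} (f : Fin k → V G) → (∀ {i j} → PathAdj i j → Adj G (f i) (f j)) →
                  ∀ i j → Walk G (f i) (f j) ∣ toℕ i - toℕ j ∣
  walkAlongPath f adj 0F 0F = here
  walkAlongPath f adj 0F 1F = step (adj (inj₂ refl)) here
  walkAlongPath f adj 1F 0F = step (adj (inj₁ refl)) here
  walkAlongPath f adj 0F (Fin.suc (Fin.suc j)) =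
    step (adj (inj₂ refl)) (walkAlongPath (f ∘ Fin.suc) (adj ∘ PathAdj-suc) 0F (Fin.suc j))
  walkAlongPath f adj (Fin.suc (Fin.suc i)) 0F =
    walk-snoc (walkAlongPath (f ∘ Fin.suc) (adj ∘ PathAdj-suc) (Fin.suc i) 0F) (adj (inj₁ refl))
  walkAlongPath f adj (Fin.suc i) (Fin.suc j) = walkAlongPath (f ∘ Fin.suc) (adj ∘ PathAdj-suc) i j

module _ {r c : ℕ} where

  manhattan : V (L r c) → V (L r c) → ℕ
  manhattan (a , i) (b , j) = ∣ toℕ a - toℕ b ∣ + ∣ toℕ i - toℕ j ∣

  manhattan-sym : ∀ u v → manhattan u v ≡ manhattan v u
  manhattan-sym (a , i) (b , j) = cong₂ _+_ (∣-∣-comm (toℕ a) (toℕ b)) (∣-∣-comm (toℕ i) (toℕ j))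

  manhattan-triangle : ∀ u v w → manhattan u w ≤ manhattan u v + manhattan v w
  manhattan-triangle (a , i) (b , j) (a′ , i′) = begin
    ∣ toℕ a - toℕ a′ ∣ + ∣ toℕ i - toℕ i′ ∣
      ≤⟨ +-mono-≤ (∣-∣-triangle (toℕ a) (toℕ b) (toℕ a′)) (∣-∣-triangle (toℕ i) (toℕ j) (toℕ i′)) ⟩
    (∣ toℕ a - toℕ b ∣ + ∣ toℕ b - toℕ a′ ∣) + (∣ toℕ i - toℕ j ∣ + ∣ toℕ j - toℕ i′ ∣)
      ≡⟨ interchange ∣ toℕ a - toℕ b ∣ _ _ _ ⟩
    (∣ toℕ a - toℕ b ∣ + ∣ toℕ i - toℕ j ∣) + (∣ toℕ b - toℕ a′ ∣ + ∣ toℕ j - toℕ i′ ∣) ∎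
    where open ≤-Reasoning

  manhattan-adj : ∀ {u v} → Adj (L r c) u v → manhattan u v ≡ 1
  manhattan-adj {a , _} (inj₁ (refl , i~j)) rewrite ∣n-n∣≡0 (toℕ a) = PathAdj⇒∣-∣≡1 i~j
  manhattan-adj {_ , i} (inj₂ (a~b , refl)) rewrite ∣n-n∣≡0 (toℕ i) | PathAdj⇒∣-∣≡1 a~b = refl

  manhattan-refl : ∀ u → manhattan u u ≡ 0
  manhattan-refl (a , i) rewrite ∣n-n∣≡0 (toℕ a) | ∣n-n∣≡0 (toℕ i) = refl

  manhattan≤length : ∀ {u v k} → Walk (L r c) u v k → manhattan u v ≤ k
  manhattan≤length {u} here = ≤-reflexive (manhattan-refl u)
  manhattan≤length {u} {v} (step {w = w} u~w p) = begin
    manhattan u v                 ≤⟨ manhattan-triangle u w v ⟩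
    manhattan u w + manhattan w v ≡⟨ cong (_+ manhattan w v) (manhattan-adj u~w) ⟩
    suc (manhattan w v)           ≤⟨ s≤s (manhattan≤length p) ⟩
    suc _                         ∎
    where open ≤-Reasoning

  manhattanWalk : ∀ u v → Walk (L r c) u v (manhattan u v)
  manhattanWalk (a , i) (b , j) =
    walkAlongPath (_, i) (λ a~b → inj₂ (a~b , refl)) a b ++ʷ
    walkAlongPath (b ,_) (λ i~j → inj₁ (refl , i~j)) i j

  manhattan-dist : ∀ u v → Dist (L r c) u v (manhattan u v)
  manhattan-dist u v = manhattanWalk u v , λ _ → manhattan≤length

  dist⇒≡manhattan : ∀ {u v d} → Dist (L r c) u v d → d ≡ manhattan u v
  dist⇒≡manhattan {u} {v} (p , shortest) = ≤-antisym (shortest _ (manhattanWalk u v)) (manhattan≤length p)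

  manhattan-ecc : ∀ {v e} w → (∀ u → manhattan v u ≤ e) → manhattan v w ≡ e → Ecc (L r c) v e
  manhattan-ecc {v} w bounded reached =
    (λ u d dist → subst (_≤ _) (sym (dist⇒≡manhattan dist)) (bounded u)) ,
    w , subst (Dist (L r c) v w) reached (manhattan-dist v w)

  ecc⇒manhattan≤ : ∀ {v e} → Ecc (L r c) v e → ∀ u → manhattan v u ≤ e
  ecc⇒manhattan≤ {v} (bounded , _) u = bounded u _ (manhattan-dist v u)

adjacentLabel : ∀ {N} → 2 ≤ N → (x : Fin N) →
                (∃ λ (y : Fin N) → toℕ y ≡ suc (toℕ x)) ⊎ (∃ λ (y : Fin N) → toℕ x ≡ suc (toℕ y))
adjacentLabel {suc (suc _)} _        0F          = inj₁ (1F , refl)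
adjacentLabel {suc zero}    (s≤s ()) 0F
adjacentLabel               _        (Fin.suc x) = inj₂ (inject₁ x , cong suc (sym (toℕ-inject₁ x)))

dispersion≤eccentricity : ∀ {G N φ k e} (c : V G) → 2 ≤ N → Dispersed G N φ k →
  (∀ u → ∃ λ d → Dist G c u d × d ≤ e) → (∀ u → ∃ λ d → Dist G u c d × d ≤ e) → k ≤ e
dispersion≤eccentricity {G} {φ = φ} c 2≤N ((_ , surjective) , dispersed) from-c to-c
  with surjective c
... | x , φx≡c with adjacentLabel 2≤N x
... | inj₁ (y , y≡1+x) = let d , dist , d≤e = from-c (φ y) in
  ≤-trans (dispersed x y y≡1+x d (subst (λ v → Dist G v (φ y) d) (sym (φx≡c refl)) dist)) d≤e
... | inj₂ (y , x≡1+y) = let d , dist , d≤e = to-c (φ y) in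
  ≤-trans (dispersed y x x≡1+y d (subst (λ v → Dist G (φ y) v d) (sym (φx≡c refl)) dist)) d≤e

castFin : ∀ {a b} → a ≡ b → Fin a ↔ Fin b
castFin eq = mk↔ₛ′ (cast eq) (cast (sym eq)) (cast-involutive eq (sym eq)) (cast-involutive (sym eq) eq)

∣m+n-n∣≡m : ∀ m n → ∣ m + n - n ∣ ≡ m
∣m+n-n∣≡m m n = trans (m≤n⇒∣n-m∣≡n∸m (m≤n+m n m)) (m+n∸n≡m m n)

∣n-m+n∣≡m : ∀ m n → ∣ n - m + n ∣ ≡ m
∣n-m+n∣≡m m n = trans (∣-∣-comm n (m + n)) (∣m+n-n∣≡m m n)

-- remQuot 2 reads a label k as (⌊k/2⌋, k mod 2); these are the possible readings of k and k + 1.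
data Consecutive {n} : Fin n × Fin 2 → Fin n × Fin 2 → Set where
  sameQuot : ∀ t → Consecutive (t , 0F) (t , 1F)
  nextQuot : ∀ {t t′} → toℕ t′ ≡ suc (toℕ t) → Consecutive (t , 1F) (t′ , 0F)

combine-consecutive : ∀ {n} (t t′ : Fin n) b b′ →
  toℕ (combine t′ b′) ≡ suc (toℕ (combine t b)) → Consecutive (t , b) (t′ , b′)
combine-consecutive t t′ b b′ eq =
  byBits b b′ (trans (sym (toℕ-combine t′ b′)) (trans eq (cong suc (toℕ-combine t b))))
  where
    a = toℕ t
    a′ = toℕ t′
    byBits : ∀ b b′ → 2 * a′ + toℕ b′ ≡ suc (2 * a + toℕ b) → Consecutive (t , b) (t′ , b′)
    byBits 0F 0F eq =
      ⊥-elim (even≢odd a′ a (trans (sym (+-identityʳ _)) (trans eq (cong suc (+-identityʳ _)))))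
    byBits 0F 1F eq
      with toℕ-injective {i = t′} {t} (*-cancelˡ-≡ a′ a 2
             (suc-injective (trans (+-comm 1 _) (trans eq (cong suc (+-identityʳ _))))))
    ... | refl = sameQuot t
    byBits 1F 0F eq = nextQuot (*-cancelˡ-≡ a′ (suc a) 2
      (trans (sym (+-identityʳ _)) (trans eq (trans (cong suc (+-comm _ 1)) (sym (*-suc 2 a))))))
    byBits 1F 1F eq =
      ⊥-elim (even≢odd a′ a (suc-injective (trans (+-comm 1 _) (trans eq (cong suc (+-comm _ 1))))))

remQuot-consecutive : ∀ {n} (i j : Fin (n * 2)) → toℕ j ≡ suc (toℕ i) →
                      Consecutive (remQuot {n} 2 i) (remQuot {n} 2 j)
remQuot-consecutive {n} i j j≡1+i = combine-consecutive _ _ _ _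
  (trans (cong toℕ (combine-remQuot {n} 2 j)) (trans j≡1+i (cong (suc ∘ toℕ) (sym (combine-remQuot {n} 2 i)))))

module OddGrid (m : ℕ) where

  n : ℕ
  n = suc m + m

  -- x ↦ x + (m + 1) mod n, obtained by swapping the blocks {0, …, m − 1} and {m, …, 2m}.
  rotation : Fin n ↔ Fin n
  rotation =
    ↔-sym (+↔⊎ {suc m} {m}) ↔-∘ (⊎-comm (Fin m) (Fin (suc m)) ↔-∘ (+↔⊎ ↔-∘ castFin (sym (+-suc m m))))

  rotate : Fin n → Fin n
  rotate = Inverse.to rotation

  rotate-byBits : ∀ x → toℕ (rotate x) ≡ suc m + toℕ x ⊎ toℕ x ≡ m + toℕ (rotate x)
  rotate-byBits x with splitAt m (cast (sym (+-suc m m)) x) in eq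
  ... | inj₁ y = inj₁ (begin
    toℕ (suc m ↑ʳ y)                      ≡⟨ toℕ-↑ʳ (suc m) y ⟩
    suc m + toℕ y                          ≡⟨ cong (suc m +_) (sym (toℕ-↑ˡ y (suc m))) ⟩
    suc m + toℕ (y ↑ˡ suc m)               ≡⟨ cong (λ z → suc m + toℕ z) (splitAt⁻¹-↑ˡ eq) ⟩
    suc m + toℕ (cast (sym (+-suc m m)) x) ≡⟨ cong (suc m +_) (toℕ-cast _ x) ⟩
    suc m + toℕ x                          ∎)
    where open ≡-Reasoning
  ... | inj₂ y = inj₂ (begin
    toℕ x                                  ≡⟨ sym (toℕ-cast _ x) ⟩
    toℕ (cast (sym (+-suc m m)) x)         ≡⟨ cong toℕ (sym (splitAt⁻¹-↑ʳ eq)) ⟩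
    toℕ (m ↑ʳ y)                           ≡⟨ toℕ-↑ʳ m y ⟩
    m + toℕ y                              ≡⟨ cong (m +_) (sym (toℕ-↑ˡ y m)) ⟩
    m + toℕ (y ↑ˡ m)                       ∎)
    where open ≡-Reasoning

  rotate-far : ∀ x → m ≤ ∣ toℕ x - toℕ (rotate x) ∣ × m ≤ ∣ toℕ (rotate x) - suc (toℕ x) ∣
  rotate-far x with rotate x | rotate-byBits x
  ... | y | inj₁ y≡1+m+x rewrite y≡1+m+x =
    ≤-trans (n≤1+n m) (≤-reflexive (sym (∣n-m+n∣≡m (suc m) (toℕ x)))) ,
    ≤-reflexive (sym (∣m+n-n∣≡m m (toℕ x)))
  ... | y | inj₂ x≡m+y rewrite x≡m+y =
    ≤-reflexive (sym (∣m+n-n∣≡m m (toℕ y))) ,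
    ≤-trans (n≤1+n m) (≤-reflexive (sym (∣n-m+n∣≡m (suc m) (toℕ y))))

  cell : Fin n × Fin 2 → V (L 2 n)
  cell (t , 0F) = 0F , t
  cell (t , 1F) = 1F , rotate t

  cell⁻¹ : V (L 2 n) → Fin n × Fin 2
  cell⁻¹ (0F , t) = t , 0F
  cell⁻¹ (1F , t) = Inverse.from rotation t , 1F

  cell↔ : (Fin n × Fin 2) ↔ V (L 2 n)
  cell↔ = mk↔ₛ′ cell cell⁻¹ cell∘cell⁻¹ cell⁻¹∘cell
    where
      cell∘cell⁻¹ : ∀ v → cell (cell⁻¹ v) ≡ v
      cell∘cell⁻¹ (0F , t) = refl
      cell∘cell⁻¹ (1F , t) = cong (1F ,_) (Inverse.strictlyInverseˡ rotation t)
      cell⁻¹∘cell : ∀ c → cell⁻¹ (cell c) ≡ c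
      cell⁻¹∘cell (t , 0F) = refl
      cell⁻¹∘cell (t , 1F) = cong (_, 1F) (Inverse.strictlyInverseʳ rotation t)

  2n≡n2 : 2 * n ≡ n * 2
  2n≡n2 = *-comm 2 n

  labelling : Fin (2 * n) ↔ V (L 2 n)
  labelling = cell↔ ↔-∘ (*↔× ↔-∘ castFin 2n≡n2)

  consecutive-cells-far : ∀ {c c′} → Consecutive c c′ → suc m ≤ manhattan (cell c) (cell c′)
  consecutive-cells-far (sameQuot t)           = s≤s (proj₁ (rotate-far t))
  consecutive-cells-far (nextQuot {t} t′≡1+t) rewrite t′≡1+t = s≤s (proj₂ (rotate-far t))

  labelling-dispersed : Dispersed (L 2 n) (2 * n) (Inverse.to labelling) (suc m)
  labelling-dispersed = Bijection.bijective (Inverse⇒Bijection labelling) ,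
    λ i j j≡1+i d dist → subst (suc m ≤_) (sym (dist⇒≡manhattan dist))
      (consecutive-cells-far (remQuot-consecutive (cast 2n≡n2 i) (cast 2n≡n2 j)
        (trans (toℕ-cast 2n≡n2 j) (trans j≡1+i (cong suc (sym (toℕ-cast 2n≡n2 i)))))))

  centre : V (L 2 n)
  centre = 0F , fromℕ< (s≤s (m≤m+n m m))

  ∣m-j∣≤m : ∀ j → j ≤ m + m → ∣ m - j ∣ ≤ m
  ∣m-j∣≤m j j≤m+m with ≤-total m j
  ... | inj₁ m≤j = begin
    ∣ m - j ∣ ≡⟨ m≤n⇒∣m-n∣≡n∸m m≤j ⟩
    j ∸ m     ≤⟨ ∸-monoˡ-≤ m j≤m+m ⟩
    m + m ∸ m ≡⟨ m+n∸n≡m m m ⟩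
    m         ∎
    where open ≤-Reasoning
  ... | inj₂ j≤m = ≤-trans (≤-reflexive (m≤n⇒∣n-m∣≡n∸m j≤m)) (m∸n≤m m j)

  centre-close : ∀ u → manhattan centre u ≤ suc m
  centre-close (a , j) rewrite toℕ-fromℕ< (s≤s (m≤m+n m m)) =
    +-mono-≤ (s≤s⁻¹ (toℕ<n a)) (∣m-j∣≤m (toℕ j) (s≤s⁻¹ (toℕ<n j)))

  centre-ecc : Ecc (L 2 n) centre (suc m)
  centre-ecc = manhattan-ecc (1F , 0F) centre-close
    (cong suc (trans (cong (∣_- 0 ∣) (toℕ-fromℕ< (s≤s (m≤m+n m m)))) (∣-∣-identityʳ m)))

  far-column : ∀ (i : Fin n) → ∃ λ (j : Fin n) → m ≤ ∣ toℕ i - toℕ j ∣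
  far-column i with ≤-total m (toℕ i)
  ... | inj₁ m≤i = 0F , subst (m ≤_) (sym (∣-∣-identityʳ (toℕ i))) m≤i
  ... | inj₂ i≤m = fromℕ (m + m) , (begin
    m                            ≡⟨ sym (m+n∸n≡m m m) ⟩
    m + m ∸ m                    ≤⟨ ∸-monoʳ-≤ (m + m) i≤m ⟩
    m + m ∸ toℕ i                ≡⟨ sym (m≤n⇒∣m-n∣≡n∸m (≤-trans i≤m (m≤m+n m m))) ⟩
    ∣ toℕ i - m + m ∣            ≡⟨ cong (∣ toℕ i -_∣) (sym (toℕ-fromℕ (m + m))) ⟩
    ∣ toℕ i - toℕ (fromℕ (m + m)) ∣ ∎)
    where open ≤-Reasoning

  far-vertex : ∀ (v : V (L 2 n)) → ∃ λ (u : V (L 2 n)) → suc m ≤ manhattan v u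
  far-vertex (0F , i) = let j , far = far-column i in (1F , j) , s≤s far
  far-vertex (1F , i) = let j , far = far-column i in (0F , j) , s≤s far

  isRadius : IsRadius (L 2 n) (suc m)
  isRadius = (centre , centre-ecc) , λ v _ ecc →
    let u , far = far-vertex v in ≤-trans far (ecc⇒manhattan≤ ecc u)

  isDL : IsDL (L 2 n) (2 * n) (suc m)
  isDL = (Inverse.to labelling , labelling-dispersed) , λ _ (_ , dispersed) →
    dispersion≤eccentricity centre (*-monoʳ-≤ 2 (s≤s z≤n)) dispersed
      (λ u → manhattan centre u , manhattan-dist centre u , centre-close u)
      (λ u → manhattan u centre , manhattan-dist u centre ,
             subst (_≤ suc m) (manhattan-sym centre u) (centre-close u))

odd⇒≡1+m+m : ∀ n → n % 2 ≡ 1 → ∃ λ m → n ≡ suc (m + m)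
odd⇒≡1+m+m n n%2≡1 = n / 2 , (begin
  n                   ≡⟨ m≡m%n+[m/n]*n n 2 ⟩
  n % 2 + n / 2 * 2   ≡⟨ cong₂ _+_ n%2≡1 (*-comm (n / 2) 2) ⟩
  suc (2 * (n / 2))   ≡⟨ cong (suc ∘ (n / 2 +_)) (+-identityʳ (n / 2)) ⟩
  suc (n / 2 + n / 2) ∎)
  where open ≡-Reasoning

⌊m+m/2⌋≡m : ∀ m → ⌊ m + m /2⌋ ≡ m
⌊m+m/2⌋≡m zero    = refl
⌊m+m/2⌋≡m (suc m) rewrite +-suc m m = cong suc (⌊m+m/2⌋≡m m)

theorem2p8 : ∀ (n : ℕ) → 3 ≤ n → n % 2 ≡ 1 →
    IsDL (L 2 n) (2 * n) ⌊ suc n /2⌋ × IsRadius (L 2 n) ⌊ suc n /2⌋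
theorem2p8 n _ n-odd with odd⇒≡1+m+m n n-odd
... | m , refl rewrite ⌊m+m/2⌋≡m m = OddGrid.isDL m , OddGrid.isRadius m
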